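{- Let $G$ be a finite chordal graph, let $v$ be a vertex of minimum degree in $G$ (i.e. a vertex that \textsc{Greedy} may pick first), and let $I$ be an arbitrary independent set of $G$. If $|N[v]\cap I| = j$ with $j\geq 2$, then $G\setminus N[v]$ has at least $j-1$ more connected components than $G$.
   Context: Graphs are finite, simple, undirected. A graph is chordal if every simple cycle on at least 4 vertices has two non-consecutive vertices that are adjacent. $N[v]=N(v)\cup\{v\}$ is the closed neighbourhood of $v$, and $G\setminus N[v]$ is the graph obtained by deleting the vertices of $N[v]$. \textsc{Greedy} is the minimum-degree greedy algorithm for independent sets, which at each step picks a vertex of minimum degree in the current graph, adds it to the solution and deletes its closed neighbourhood. -}

module Defs where

open import Data.Nat using (ℕ; zero; suc; _+_; _≤_)
open import Data.Fin using (Fin; toℕ)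
open import Data.List using (List; length; filter)
open import Data.List.Base using (allFin)
open import Data.Product using (Σ; ∃; ∃-syntax; _×_; _,_)
open import Data.Sum using (_⊎_)
open import Data.Unit using (⊤)
open import Data.Empty using (⊥)
open import Relation.Nullary using (¬_; Dec)
open import Relation.Nullary.Decidable using (_⊎-dec_; _×-dec_)
open import Relation.Binary.PropositionalEquality using (_≡_; _≢_)
open import Data.Fin.Subset using (Subset; _∈_)
open import Data.Fin.Subset.Properties using (_∈?_)
open import Data.Fin.Properties using (_≟_)
open import Function.Bundles using (_⇔_)

record Graph (n : ℕ) : Set₁ where
  field
    Adj    : Fin n → Fin n → Set
    adj?   : (u w : Fin n) → Dec (Adj u w)
    sym    : ∀ {u w} → Adj u w → Adj w u
    irrefl : ∀ {u} → ¬ Adj u u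

module _ {n : ℕ} (G : Graph n) where
  open Graph G

  degree : Fin n → ℕ
  degree v = length (filter (adj? v) (allFin n))

  MinDegree : Fin n → Set
  MinDegree v = ∀ u → degree v ≤ degree u

  ClosedNbhd : Fin n → Fin n → Set
  ClosedNbhd v w = (w ≡ v) ⊎ Adj v w

  closedNbhd? : (v w : Fin n) → Dec (ClosedNbhd v w)
  closedNbhd? v w = (w ≟ v) ⊎-dec adj? v w

  Independent : Subset n → Set
  Independent I = ∀ u w → u ∈ I → w ∈ I → ¬ Adj u w

  nbhdMeet : Fin n → Subset n → ℕ
  nbhdMeet v I = length (filter (λ w → closedNbhd? v w ×-dec (w ∈? I)) (allFin n))

  Next : (k : ℕ) → Fin k → Fin k → Set
  Next k i j = (suc (toℕ i) ≡ toℕ j) ⊎ ((suc (toℕ i) ≡ k) × (toℕ j ≡ 0))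

  IsCycle : (k : ℕ) → (Fin k → Fin n) → Set
  IsCycle k c = (∀ i j → c i ≡ c j → i ≡ j) × (∀ i j → Next k i j → Adj (c i) (c j))

  HasChord : (k : ℕ) → (Fin k → Fin n) → Set
  HasChord k c = ∃[ i ] ∃[ j ] (i ≢ j × ¬ Next k i j × ¬ Next k j i × Adj (c i) (c j))

  Chordal : Set
  Chordal = ∀ k (c : Fin k → Fin n) → 4 ≤ k → IsCycle k c → HasChord k c

  data Reach (S : Fin n → Set) : Fin n → Fin n → Set where
    here : ∀ {u} → S u → Reach S u u
    step : ∀ {u w x} → S u → Adj u w → Reach S w x → Reach S u x

  -- G[S] has exactly m connected components: there is a labelling of the
  -- vertices of S by Fin m, onto, such that two vertices get the same label
  -- iff they lie in the same connected component of G[S].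
  HasComponents : (S : Fin n → Set) → ℕ → Set
  HasComponents S m =
    Σ ((u : Fin n) → S u → Fin m) λ lab →
      (∀ (a : Fin m) → ∃[ u ] Σ (S u) λ su → lab u su ≡ a) ×
      (∀ u w (su : S u) (sw : S w) → (lab u su ≡ lab w sw) ⇔ Reach S u w)

  AllVertices : Fin n → Set
  AllVertices _ = ⊤

  OutsideNbhd : Fin n → Fin n → Set
  OutsideNbhd v w = ¬ ClosedNbhd v w

{-# OPTIONS --safe #-}
module Submission where

-- Since j ≥ 2, the vertex v is not in I, so N[v] ∩ I consists of j pairwise
-- non-adjacent neighbours w₁, …, w_j of v.  Minimality of deg v gives every wᵢ a
-- neighbour xᵢ outside N[v]: otherwise N(wᵢ) ⊆ N[v] ∖ {wᵢ, w_k} for any k ≠ i, and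
-- deg wᵢ < deg v.  In a chordal graph no path of G ∖ N[v] joins xᵢ to x_k: a
-- shortest walk from wᵢ to w_k through G ∖ N[v] is an induced path, which together
-- with v is a chordless cycle of length at least 4.  So the component of v in G
-- falls apart into at least j components of G ∖ N[v], while every other component
-- of G is disjoint from N[v] and survives.

open import Defs
open import Data.Nat using (ℕ; zero; suc; _+_; _∸_; _≤_; _<_; z≤n; s≤s; z<s; s≤s⁻¹)
open import Data.Nat.Properties
  using ( +-suc; +-monoˡ-<; m≤m+n; m+n≤o⇒m≤o; m+n≤o⇒n≤o; m+n≤o⇒m≤o∸n; m∸n+n≡m; m+[n∸m]≡n
        ; ∸-monoʳ-<; m<n⇒0<n∸m; ≤-refl; <-trans; <-≤-trans; ≤-<-trans; <⇒≤; n<1+n; m<n⇒m<1+n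
        ; <-cmp; ≤-<-connex; ≮⇒≥; <⇒≱; ≤∧≢⇒<; m≤n⇒m<n∨m≡n; suc-injective; module ≤-Reasoning)
open import Data.Nat.Induction using (<-rec)
open import Data.Fin using (Fin; zero; suc; toℕ; punchIn)
open import Data.Fin.Properties
  using (_≟_; any?; toℕ<n; toℕ-injective; injective⇒≤; +↔⊎; punchInᵢ≢i; 0≢1+n)
  renaming (suc-injective to Fin-suc-injective)
open import Data.Fin.Subset using (Subset; _∈_)
open import Data.Fin.Subset.Properties using (_∈?_)
open import Data.List using (List; []; _∷_; length; filter; lookup; allFin)
open import Data.List.Properties using (filter-accept; filter-reject; filter-none)
import Data.List.Membership.Propositional as List
open import Data.List.Membership.Propositional.Properties using (∈-lookup; ∈-filter⁻; ∈-allFin)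
open import Data.List.Relation.Binary.Sublist.Propositional using (⊆-refl)
import Data.List.Relation.Binary.Sublist.Propositional.Properties as Sublist
open import Data.List.Relation.Binary.Sublist.Propositional.Properties using (length-mono-≤)
open import Data.List.Relation.Unary.All as All using ()
open import Data.List.Relation.Unary.AllPairs using (_∷_)
open import Data.List.Relation.Unary.Any using (here; there)
open import Data.List.Relation.Unary.Unique.Propositional using (Unique)
open import Data.List.Relation.Unary.Unique.Propositional.Properties using (allFin⁺; filter⁺)
open import Data.Product using (∃-syntax; _×_; _,_; proj₁; proj₂)
open import Data.Sum using (_⊎_; inj₁; inj₂)
open import Data.Unit using (tt)
open import Data.Empty using (⊥; ⊥-elim)
open import Function using (_∘_; Injection)
open import Function.Bundles using (Equivalence)
open import Function.Definitions using (Injective)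
open import Function.Properties.Inverse using (↔⇒↣)
open import Relation.Binary using (DecidableEquality; tri<; tri≈; tri>)
open import Relation.Binary.PropositionalEquality
  using (_≡_; _≢_; refl; sym; trans; cong; cong₂; subst; subst₂; ≢-sym)
open import Relation.Nullary using (¬_; yes; no; ¬?)
open import Relation.Nullary.Decidable using (_⊎-dec_; _×-dec_; decidable-stable)
open import Relation.Unary using (Decidable)

module _ {A : Set} {P Q : A → Set} (P? : Decidable P) (Q? : Decidable Q) where

  length-filter-mono : (∀ {x} → P x → Q x) → ∀ xs → length (filter P? xs) ≤ length (filter Q? xs)
  length-filter-mono P⇒Q xs = length-mono-≤ (Sublist.filter⁺ P? Q? (λ { refl → P⇒Q }) (⊆-refl {x = xs}))

  length-filter-⊎ : (∀ {x} → P x → ¬ Q x) → ∀ xs →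
    length (filter (λ x → P? x ⊎-dec Q? x) xs) ≡ length (filter P? xs) + length (filter Q? xs)
  length-filter-⊎ disjoint [] = refl
  length-filter-⊎ disjoint (x ∷ xs) with P? x | Q? x
  ... | yes p | yes q = ⊥-elim (disjoint p q)
  ... | yes _ | no _  = cong suc (length-filter-⊎ disjoint xs)
  ... | no _  | yes _ = trans (cong suc (length-filter-⊎ disjoint xs)) (sym (+-suc _ _))
  ... | no _  | no _  = length-filter-⊎ disjoint xs

module _ {A : Set} (_≟ᴬ_ : DecidableEquality A) where

  length-filter-≟ : ∀ {x xs} → Unique xs → x List.∈ xs → length (filter (_≟ᴬ x) xs) ≡ 1
  length-filter-≟ {x} (x∉ys ∷ _) (here refl) =
    cong length (trans (filter-accept (_≟ᴬ x) refl) (cong (x ∷_) (filter-none (_≟ᴬ x) (All.map ≢-sym x∉ys))))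
  length-filter-≟ {x} (y∉ys ∷ ys-unique) (there x∈ys) =
    trans (cong length (filter-reject (_≟ᴬ x) (All.lookup y∉ys x∈ys))) (length-filter-≟ ys-unique x∈ys)

lookup-injective : ∀ {A : Set} {xs : List A} → Unique xs → Injective _≡_ _≡_ (lookup xs)
lookup-injective {xs = _ ∷ _}  _            {zero}  {zero}  _  = refl
lookup-injective {xs = _ ∷ xs} (x∉xs ∷ _)   {zero}  {suc j} eq = ⊥-elim (All.lookup x∉xs (∈-lookup j) eq)
lookup-injective {xs = _ ∷ xs} (x∉xs ∷ _)   {suc i} {zero}  eq = ⊥-elim (All.lookup x∉xs (∈-lookup i) (sym eq))
lookup-injective {xs = _ ∷ _}  (_ ∷ unique) {suc i} {suc j} eq = cong suc (lookup-injective unique eq)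

-- skipIndex s d enumerates ℕ with the d numbers s + 1, …, s + d left out.
skipIndex : ℕ → ℕ → ℕ → ℕ
skipIndex zero    d zero    = zero
skipIndex zero    d (suc i) = suc (i + d)
skipIndex (suc s) d zero    = zero
skipIndex (suc s) d (suc i) = suc (skipIndex s d i)

skipIndex-≤ : ∀ {s d i} → i ≤ s → skipIndex s d i ≡ i
skipIndex-≤ {zero}  {i = zero}  _         = refl
skipIndex-≤ {suc s} {i = zero}  _         = refl
skipIndex-≤ {suc s} {i = suc i} (s≤s i≤s) = cong suc (skipIndex-≤ i≤s)

skipIndex-> : ∀ {s d i} → s < i → skipIndex s d i ≡ i + d
skipIndex-> {zero}  {i = suc i} _         = refl
skipIndex-> {suc s} {i = suc i} (s≤s s<i) = cong suc (skipIndex-> s<i)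

module _ {n : ℕ} (G : Graph n) where
  open Graph G renaming (sym to adj-sym)

  degree<-of-enclosed : ∀ {v w w'} → (∀ {x} → Adj w x → ClosedNbhd G v x) →
    Adj v w → Adj v w' → w ≢ w' → ¬ Adj w w' → degree G w < degree G v
  degree<-of-enclosed {v} {w} {w'} enclosed vw vw' w≢w' w≁w' = s≤s⁻¹ (begin
    2 + degree G w                            ≡⟨ cong₂ (λ p q → p + q + degree G w) (count≡ w) (count≡ w') ⟨
    count (_≟ w) + count (_≟ w') + degree G w ≡⟨ cong (_+ degree G w) (count-⊎ (_≟ w) (_≟ w') ≡w⇒≢w') ⟨
    count pair + degree G w                   ≡⟨ count-⊎ pair (adj? w) pair-non-adjacent ⟨
    count (λ x → pair x ⊎-dec adj? w x)       ≤⟨ length-filter-mono _ (closedNbhd? G v) inside (allFin n) ⟩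
    count (closedNbhd? G v)                   ≡⟨ count-⊎ (_≟ v) (adj? v) (λ { refl → irrefl }) ⟩
    count (_≟ v) + degree G v                 ≡⟨ cong (_+ degree G v) (count≡ v) ⟩
    1 + degree G v                            ∎)
    where
    open ≤-Reasoning
    count : ∀ {P : Fin n → Set} → Decidable P → ℕ
    count P? = length (filter P? (allFin n))
    count≡ : ∀ x → count (_≟ x) ≡ 1
    count≡ x = length-filter-≟ _≟_ (allFin⁺ n) (∈-allFin x)
    count-⊎ : ∀ {P Q : Fin n → Set} (P? : Decidable P) (Q? : Decidable Q) → (∀ {x} → P x → ¬ Q x) →
      count (λ x → P? x ⊎-dec Q? x) ≡ count P? + count Q?
    count-⊎ P? Q? disjoint = length-filter-⊎ P? Q? disjoint (allFin n)
    ≡w⇒≢w' : ∀ {x} → x ≡ w → x ≢ w'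
    ≡w⇒≢w' refl = w≢w'
    pair : Decidable (λ x → x ≡ w ⊎ x ≡ w')
    pair x = (x ≟ w) ⊎-dec (x ≟ w')
    pair-non-adjacent : ∀ {x} → x ≡ w ⊎ x ≡ w' → ¬ Adj w x
    pair-non-adjacent (inj₁ refl) = irrefl
    pair-non-adjacent (inj₂ refl) = w≁w'
    inside : ∀ {x} → (x ≡ w ⊎ x ≡ w') ⊎ Adj w x → ClosedNbhd G v x
    inside (inj₁ (inj₁ refl)) = inj₂ vw
    inside (inj₁ (inj₂ refl)) = inj₂ vw'
    inside (inj₂ wx)          = enclosed wx

  min-degree⇒outside-neighbour : ∀ {v w w'} → MinDegree G v →
    Adj v w → Adj v w' → w ≢ w' → ¬ Adj w w' → ∃[ x ] (Adj w x × OutsideNbhd G v x)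
  min-degree⇒outside-neighbour {v} {w} min vw vw' w≢w' w≁w'
    with any? (λ x → adj? w x ×-dec ¬? (closedNbhd? G v x))
  ... | yes found = found
  ... | no none = ⊥-elim (<⇒≱ (degree<-of-enclosed enclosed vw vw' w≢w' w≁w') (min w))
    where
    enclosed : ∀ {x} → Adj w x → ClosedNbhd G v x
    enclosed {x} wx = decidable-stable (closedNbhd? G v x) (λ outside → none (x , wx , outside))

  Reach-mono : ∀ {S T : Fin n → Set} {a b} → (∀ {u} → S u → T u) → Reach G S a b → Reach G T a b
  Reach-mono S⊆T (here sa)       = here (S⊆T sa)
  Reach-mono S⊆T (step sa ab rb) = step (S⊆T sa) ab (Reach-mono S⊆T rb)

  -- The endpoints of a walk need not lie in S; `at` is unconstrained beyond `len`.
  record Walk (S : Fin n → Set) (a b : Fin n) : Set where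
    field
      len      : ℕ
      at       : ℕ → Fin n
      at-start : at 0 ≡ a
      at-end   : at len ≡ b
      adjacent : ∀ {t} → t < len → Adj (at t) (at (suc t))
      interior : ∀ {t} → 0 < t → t < len → S (at t)

  open Walk

  edge-walk : ∀ {S a b} → Adj a b → Walk S a b
  edge-walk {a = a} {b} ab = record
    { len = 1 ; at = λ { zero → a ; (suc _) → b } ; at-start = refl ; at-end = refl
    ; adjacent = λ { (s≤s z≤n) → ab } ; interior = λ { (s≤s z≤n) (s≤s ()) } }

  cons-walk : ∀ {S u a b} → Adj u a → S a → Walk S a b → Walk S u b
  cons-walk {S} {u} ua sa W = record
    { len = suc (len W) ; at = λ { zero → u ; (suc t) → at W t } ; at-start = refl ; at-end = at-end W
    ; adjacent = λ { {zero} _ → subst (Adj u) (sym (at-start W)) ua ; {suc t} (s≤s t<len) → adjacent W t<len }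
    ; interior = λ { {suc zero} _ _ → subst S (sym (at-start W)) sa
                   ; {suc (suc t)} _ (s≤s t<len) → interior W z<s t<len } }

  Reach⇒Walk : ∀ {S a x y b} → Adj a x → Reach G S x y → Adj y b → Walk S a b
  Reach⇒Walk ax (here sx)       yb = cons-walk ax sx (edge-walk yb)
  Reach⇒Walk ax (step sx xz rz) yb = cons-walk ax sx (Reach⇒Walk xz rz yb)

  walk-len≥2 : ∀ {S a b} → a ≢ b → ¬ Adj a b → (W : Walk S a b) → 2 ≤ len W
  walk-len≥2 a≢b a≁b W with len W | at-end W | adjacent W
  ... | zero        | end | _   = ⊥-elim (a≢b (trans (sym (at-start W)) end))
  ... | suc zero    | end | adj = ⊥-elim (a≁b (subst₂ Adj (at-start W) end (adj z<s)))
  ... | suc (suc _) | _   | _   = s≤s (s≤s z≤n)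

  module _ {S : Fin n → Set} {a b : Fin n} (W : Walk S a b) where

    truncate : ∀ {s} → s ≤ len W → at W s ≡ b → Walk S a b
    truncate {s} s≤len as≡b = record
      { len = s ; at = at W ; at-start = at-start W ; at-end = as≡b
      ; adjacent = λ t<s → adjacent W (<-≤-trans t<s s≤len)
      ; interior = λ 0<t t<s → interior W 0<t (<-≤-trans t<s s≤len) }

    skip : ∀ s d → suc s + d ≤ len W → Adj (at W s) (at W (suc s + d)) → Walk S a b
    skip s d bound chord = record
      { len = len W ∸ d ; at = at W ∘ skipIndex s d
      ; at-start = trans (cong (at W) (skipIndex-≤ z≤n)) (at-start W)
      ; at-end = trans (cong (at W) (trans (skipIndex-> s<len') (m∸n+n≡m d≤len))) (at-end W)
      ; adjacent = adjacent′ ; interior = interior′ }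
      where
      d≤len : d ≤ len W
      d≤len = m+n≤o⇒n≤o (suc s) bound
      s<len : s < len W
      s<len = m+n≤o⇒m≤o (suc s) bound
      s<len' : s < len W ∸ d
      s<len' = m+n≤o⇒m≤o∸n (suc s) bound
      shifted<len : ∀ {i} → i < len W ∸ d → i + d < len W
      shifted<len i<len' = subst (_ <_) (m∸n+n≡m d≤len) (+-monoˡ-< d i<len')
      Adj-at : ℕ → ℕ → Set
      Adj-at p q = Adj (at W p) (at W q)
      adjacent′ : ∀ {i} → i < len W ∸ d → Adj-at (skipIndex s d i) (skipIndex s d (suc i))
      adjacent′ {i} i<len' with <-cmp i s
      ... | tri< i<s _ _ = subst₂ Adj-at (sym (skipIndex-≤ (<⇒≤ i<s))) (sym (skipIndex-≤ i<s))
                             (adjacent W (<-trans i<s s<len))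
      ... | tri≈ _ refl _ = subst₂ Adj-at (sym (skipIndex-≤ ≤-refl)) (sym (skipIndex-> (n<1+n s))) chord
      ... | tri> _ _ s<i = subst₂ Adj-at (sym (skipIndex-> s<i)) (sym (skipIndex-> (m<n⇒m<1+n s<i)))
                             (adjacent W (shifted<len i<len'))
      interior′ : ∀ {i} → 0 < i → i < len W ∸ d → S (at W (skipIndex s d i))
      interior′ {i} 0<i i<len' with ≤-<-connex i s
      ... | inj₁ i≤s = subst (S ∘ at W) (sym (skipIndex-≤ i≤s)) (interior W 0<i (≤-<-trans i≤s s<len))
      ... | inj₂ s<i = subst (S ∘ at W) (sym (skipIndex-> s<i))
                         (interior W (<-≤-trans 0<i (m≤m+n i d)) (shifted<len i<len'))

  Shortest : ∀ {S a b} → Walk S a b → Set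
  Shortest {S} {a} {b} W = ∀ (W' : Walk S a b) → len W ≤ len W'

  ¬Shortest⇒¬Walk : ∀ {S a b} → (∀ (W : Walk S a b) → ¬ Shortest W) → ¬ Walk S a b
  ¬Shortest⇒¬Walk refute W = <-rec (λ m → ∀ W → len W ≡ m → ⊥) shorter-refuted (len W) W refl
    where
    shorter-refuted : ∀ m → (∀ {m'} → m' < m → ∀ W → len W ≡ m' → ⊥) → ∀ W → len W ≡ m → ⊥
    shorter-refuted _ below W refl = refute W (λ W' → ≮⇒≥ (λ W'<W → below W'<W W' refl))

  record Induced {S a b} (W : Walk S a b) : Set where
    field
      distinct  : ∀ {s t} → s < t → t ≤ len W → at W s ≢ at W t
      chordless : ∀ {s t} → suc s < t → t ≤ len W → ¬ Adj (at W s) (at W t)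

  shortest⇒induced : ∀ {S a b} (W : Walk S a b) → Shortest W → Induced W
  shortest⇒induced W shortest = record { distinct = distinct ; chordless = chordless }
    where
    chordless : ∀ {s t} → suc s < t → t ≤ len W → ¬ Adj (at W s) (at W t)
    chordless {s} {t} s+1<t t≤len st = <⇒≱ shorter (shortest (skip W s d bound chord))
      where
      d : ℕ
      d = t ∸ suc s
      s+1+d≡t : suc s + d ≡ t
      s+1+d≡t = m+[n∸m]≡n (<⇒≤ s+1<t)
      bound : suc s + d ≤ len W
      bound = subst (_≤ len W) (sym s+1+d≡t) t≤len
      chord : Adj (at W s) (at W (suc s + d))
      chord = subst (Adj (at W s) ∘ at W) (sym s+1+d≡t) st
      shorter : len W ∸ d < len W
      shorter = ∸-monoʳ-< (m<n⇒0<n∸m s+1<t) (m+n≤o⇒n≤o (suc s) bound)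
    distinct : ∀ {s t} → s < t → t ≤ len W → at W s ≢ at W t
    distinct {s} {t} s<t t≤len as≡at with m≤n⇒m<n∨m≡n t≤len
    ... | inj₁ t<len = chordless (s≤s s<t) t<len (subst (λ p → Adj p (at W (suc t))) (sym as≡at) (adjacent W t<len))
    ... | inj₂ refl = <⇒≱ s<t (shortest (truncate W (<⇒≤ s<t) (trans as≡at (at-end W))))

  module DetourCycle {v a b} (va : Adj v a) (vb : Adj v b)
                     (W : Walk (OutsideNbhd G v) a b) (induced : Induced W) where
    open Induced induced

    k : ℕ
    k = suc (suc (len W))

    cycle : ℕ → Fin n
    cycle zero    = v
    cycle (suc t) = at W t

    near-v⇒endpoint : ∀ {t} → t ≤ len W → ClosedNbhd G v (at W t) → t ≡ 0 ⊎ t ≡ len W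
    near-v⇒endpoint {zero}  _     _    = inj₁ refl
    near-v⇒endpoint {suc t} t≤len near with m≤n⇒m<n∨m≡n t≤len
    ... | inj₁ t<len = ⊥-elim (interior W z<s t<len near)
    ... | inj₂ t≡len = inj₂ t≡len

    v∉walk : ∀ {t} → t ≤ len W → at W t ≢ v
    v∉walk t≤len at≡v with near-v⇒endpoint t≤len (inj₁ at≡v)
    ... | inj₁ refl = irrefl (subst (Adj v) (trans (sym (at-start W)) at≡v) va)
    ... | inj₂ refl = irrefl (subst (Adj v) (trans (sym (at-end W)) at≡v) vb)

    cycle-distinct : ∀ {i j} → i < j → j < k → cycle i ≢ cycle j
    cycle-distinct {zero}  {suc t} _         (s≤s (s≤s t≤len)) = v∉walk t≤len ∘ sym
    cycle-distinct {suc s} {suc t} (s≤s s<t) (s≤s (s≤s t≤len)) = distinct s<t t≤len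

    cycle-step : ∀ {t} → suc t < k → Adj (cycle t) (cycle (suc t))
    cycle-step {zero}  _                 = subst (Adj v) (sym (at-start W)) va
    cycle-step {suc t} (s≤s (s≤s t<len)) = adjacent W t<len

    no-chord-between : ∀ {i j} → i < j → j < k → suc i ≢ j → ¬ (suc j ≡ k × i ≡ 0) →
      ¬ Adj (cycle i) (cycle j)
    no-chord-between {zero} {suc t} _ (s≤s (s≤s t≤len)) not-next not-closing vat
      with near-v⇒endpoint t≤len (inj₂ vat)
    ... | inj₁ refl = not-next refl
    ... | inj₂ refl = not-closing (refl , refl)
    no-chord-between {suc s} {suc t} (s≤s s<t) (s≤s (s≤s t≤len)) not-next _ =
      chordless (≤∧≢⇒< s<t (not-next ∘ cong suc)) t≤len

    isCycle : IsCycle G k (cycle ∘ toℕ)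
    isCycle = injective , adjacent-if-next
      where
      injective : ∀ i j → cycle (toℕ i) ≡ cycle (toℕ j) → i ≡ j
      injective i j eq with <-cmp (toℕ i) (toℕ j)
      ... | tri< i<j _ _ = ⊥-elim (cycle-distinct i<j (toℕ<n j) eq)
      ... | tri≈ _ i≡j _ = toℕ-injective i≡j
      ... | tri> _ _ j<i = ⊥-elim (cycle-distinct j<i (toℕ<n i) (sym eq))
      adjacent-if-next : ∀ i j → Next G k i j → Adj (cycle (toℕ i)) (cycle (toℕ j))
      adjacent-if-next i j (inj₁ i+1≡j) =
        subst (Adj (cycle (toℕ i)) ∘ cycle) i+1≡j (cycle-step (subst (_< k) (sym i+1≡j) (toℕ<n j)))
      adjacent-if-next i j (inj₂ (i+1≡k , j≡0)) rewrite suc-injective i+1≡k | j≡0 =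
        adj-sym (subst (Adj v) (sym (at-end W)) vb)

    cycle-chordless : ¬ HasChord G k (cycle ∘ toℕ)
    cycle-chordless (i , j , i≢j , ¬next-ij , ¬next-ji , chord) with <-cmp (toℕ i) (toℕ j)
    ... | tri< i<j _ _ = no-chord-between i<j (toℕ<n j) (¬next-ij ∘ inj₁) (¬next-ji ∘ inj₂) chord
    ... | tri≈ _ i≡j _ = i≢j (toℕ-injective i≡j)
    ... | tri> _ _ j<i = no-chord-between j<i (toℕ<n i) (¬next-ji ∘ inj₁) (¬next-ij ∘ inj₂) (adj-sym chord)

  chordal⇒¬induced-detour : Chordal G → ∀ {v a b} → Adj v a → Adj v b →
    (W : Walk (OutsideNbhd G v) a b) → 2 ≤ len W → ¬ Induced W
  chordal⇒¬induced-detour chordal va vb W long induced =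
    cycle-chordless (chordal k (cycle ∘ toℕ) (s≤s (s≤s long)) isCycle)
    where open DetourCycle va vb W induced

  chordal⇒¬detour : Chordal G → ∀ {v w w'} → Adj v w → Adj v w' → w ≢ w' → ¬ Adj w w' →
    ¬ Walk (OutsideNbhd G v) w w'
  chordal⇒¬detour chordal vw vw' w≢w' w≁w' = ¬Shortest⇒¬Walk λ W shortest →
    chordal⇒¬induced-detour chordal vw vw' W (walk-len≥2 w≢w' w≁w' W) (shortest⇒induced W shortest)

  module Deletion {S : Fin n → Set} {c₁ c₂ m}
                  (H₁ : HasComponents G (AllVertices G) c₁) (H₂ : HasComponents G S c₂)
                  (v : Fin n) (far⇒S : ∀ u → ¬ Reach G (AllVertices G) v u → S u)
                  (x : Fin (suc m) → Fin n) (x∈S : ∀ i → S (x i))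
                  (v⇝x : ∀ i → Reach G (AllVertices G) v (x i))
                  (separated : ∀ i i' → Reach G S (x i) (x i') → i ≡ i') where

    lab₁ : ∀ u → AllVertices G u → Fin c₁
    lab₁ = proj₁ H₁

    lab₂ : ∀ u → S u → Fin c₂
    lab₂ = proj₁ H₂

    C : Fin c₁
    C = lab₁ v tt

    connected : ∀ {u u'} → Reach G (AllVertices G) u u' → lab₁ u tt ≡ lab₁ u' tt
    connected = Equivalence.from (proj₂ (proj₂ H₁) _ _ tt tt)

    S-path : ∀ {u u' su su'} → lab₂ u su ≡ lab₂ u' su' → Reach G S u u'
    S-path = Equivalence.to (proj₂ (proj₂ H₂) _ _ _ _)

    S-connected : ∀ {u u' su su'} → lab₂ u su ≡ lab₂ u' su' → lab₁ u tt ≡ lab₁ u' tt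
    S-connected = connected ∘ Reach-mono _ ∘ S-path

    -- The component C of v is represented by x zero, every other one by any of its vertices.
    record Anchor (a : Fin c₁) : Set where
      field
        vertex : Fin n
        inside : S vertex
        label  : lab₁ vertex tt ≡ a
        is-x₀  : a ≡ C → vertex ≡ x zero

    anchor : ∀ a → Anchor a
    anchor a with a ≟ C
    ... | yes refl = record
      { vertex = x zero ; inside = x∈S zero ; label = sym (connected (v⇝x zero)) ; is-x₀ = λ _ → refl }
    ... | no a≢C   = record
      { vertex = u ; inside = far⇒S u (a≢C ∘ v⇝u⇒a≡C) ; label = lab-u ; is-x₀ = ⊥-elim ∘ a≢C }
      where
      u : Fin n
      u = proj₁ (proj₁ (proj₂ H₁) a)
      lab-u : lab₁ u tt ≡ a
      lab-u = proj₂ (proj₂ (proj₁ (proj₂ H₁) a))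
      v⇝u⇒a≡C : Reach G (AllVertices G) v u → a ≡ C
      v⇝u⇒a≡C v⇝u = trans (sym lab-u) (sym (connected v⇝u))

    open Anchor

    φ : Fin c₁ ⊎ Fin m → Fin c₂
    φ (inj₁ a) = lab₂ (vertex (anchor a)) (inside (anchor a))
    φ (inj₂ i) = lab₂ (x (suc i)) (x∈S (suc i))

    anchor-apart : ∀ a i → φ (inj₁ a) ≢ φ (inj₂ i)
    anchor-apart a i eq =
      0≢1+n (separated zero (suc i) (subst (λ u → Reach G S u (x (suc i))) (is-x₀ (anchor a) a≡C) (S-path eq)))
      where
      a≡C : a ≡ C
      a≡C = trans (sym (label (anchor a))) (trans (S-connected eq) (sym (connected (v⇝x (suc i)))))

    φ-injective : Injective _≡_ _≡_ φ
    φ-injective {inj₁ a} {inj₁ a'} eq =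
      cong inj₁ (trans (sym (label (anchor a))) (trans (S-connected eq) (label (anchor a'))))
    φ-injective {inj₁ a} {inj₂ i}  eq = ⊥-elim (anchor-apart a i eq)
    φ-injective {inj₂ i} {inj₁ a}  eq = ⊥-elim (anchor-apart a i (sym eq))
    φ-injective {inj₂ i} {inj₂ i'} eq = cong inj₂ (Fin-suc-injective (separated _ _ (S-path eq)))

  components-after-deletion : ∀ {S : Fin n → Set} {c₁ c₂ m} →
    HasComponents G (AllVertices G) c₁ → HasComponents G S c₂ →
    (v : Fin n) → (∀ u → ¬ Reach G (AllVertices G) v u → S u) →
    (x : Fin (suc m) → Fin n) → (∀ i → S (x i)) → (∀ i → Reach G (AllVertices G) v (x i)) →
    (∀ i i' → Reach G S (x i) (x i') → i ≡ i') → c₁ + m ≤ c₂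
  components-after-deletion H₁ H₂ v far⇒S x x∈S v⇝x separated =
    injective⇒≤ (Injection.injective (↔⇒↣ +↔⊎) ∘ φ-injective)
    where open Deletion H₁ H₂ v far⇒S x x∈S v⇝x separated

  independent-in-N[v]⇒adjacent : ∀ {v} {I : Subset n} → Independent G I → ∀ {j} → 2 ≤ j →
    (w : Fin j → Fin n) → Injective _≡_ _≡_ w → (∀ i → ClosedNbhd G v (w i) × w i ∈ I) →
    ∀ i → Adj v (w i)
  independent-in-N[v]⇒adjacent {v} {I} independent (s≤s (s≤s _)) w w-injective w∈ i
    with w∈ i | w∈ (punchIn i zero)
  ... | inj₂ vw , _ | _ = vw
  ... | inj₁ w≡v , _ | inj₁ w'≡v , _ = ⊥-elim (punchInᵢ≢i i zero (w-injective (trans w'≡v (sym w≡v))))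
  ... | inj₁ w≡v , w∈I | inj₂ vw' , w'∈I = ⊥-elim (independent _ _ (subst (_∈ I) w≡v w∈I) w'∈I vw')

  independent-neighbours-split : Chordal G → ∀ {v c₁ c₂ j} → MinDegree G v → 2 ≤ j →
    (w : Fin j → Fin n) → Injective _≡_ _≡_ w → (∀ i → Adj v (w i)) → (∀ i i' → ¬ Adj (w i) (w i')) →
    HasComponents G (AllVertices G) c₁ → HasComponents G (OutsideNbhd G v) c₂ → c₁ + (j ∸ 1) ≤ c₂
  independent-neighbours-split chordal {v} min (s≤s (s≤s {n = k} _)) w w-injective vw w≁w H₁ H₂ =
    components-after-deletion H₁ H₂ v near-v x x-outside v⇝x separated
    where
    w-distinct : ∀ {i i'} → i ≢ i' → w i ≢ w i'
    w-distinct i≢i' = i≢i' ∘ w-injective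
    outside : ∀ i → ∃[ x ] (Adj (w i) x × OutsideNbhd G v x)
    outside i = min-degree⇒outside-neighbour min (vw i) (vw (punchIn i zero))
                  (w-distinct (≢-sym (punchInᵢ≢i i zero))) (w≁w i (punchIn i zero))
    x : Fin (suc (suc k)) → Fin n
    x = proj₁ ∘ outside
    wx : ∀ i → Adj (w i) (x i)
    wx i = proj₁ (proj₂ (outside i))
    x-outside : ∀ i → OutsideNbhd G v (x i)
    x-outside i = proj₂ (proj₂ (outside i))
    near-v : ∀ u → ¬ Reach G (AllVertices G) v u → OutsideNbhd G v u
    near-v u v̸⇝u (inj₁ refl) = v̸⇝u (here tt)
    near-v u v̸⇝u (inj₂ vu)   = v̸⇝u (step tt vu (here tt))
    v⇝x : ∀ i → Reach G (AllVertices G) v (x i)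
    v⇝x i = step tt (vw i) (step tt (wx i) (here tt))
    separated : ∀ i i' → Reach G (OutsideNbhd G v) (x i) (x i') → i ≡ i'
    separated i i' x⇝x' with i ≟ i'
    ... | yes i≡i' = i≡i'
    ... | no i≢i'  = ⊥-elim (chordal⇒¬detour chordal (vw i) (vw i') (w-distinct i≢i') (w≁w i i')
                               (Reach⇒Walk (wx i) x⇝x' (adj-sym (wx i'))))

lemma2 : ∀ {n} (G : Graph n) → Chordal G → (v : Fin n) → MinDegree G v →
         (I : Subset n) → Independent G I → (j : ℕ) → nbhdMeet G v I ≡ j → 2 ≤ j →
         (c₁ c₂ : ℕ) → HasComponents G (AllVertices G) c₁ →
         HasComponents G (OutsideNbhd G v) c₂ → c₁ + (j ∸ 1) ≤ c₂
lemma2 {n} G chordal v min I independent j refl 2≤j c₁ c₂ H₁ H₂ =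
  independent-neighbours-split G chordal min 2≤j w w-injective v-w w≁w H₁ H₂
  where
  meets? : Decidable (λ u → ClosedNbhd G v u × u ∈ I)
  meets? u = closedNbhd? G v u ×-dec (u ∈? I)
  w : Fin (nbhdMeet G v I) → Fin n
  w = lookup (filter meets? (allFin n))
  w-injective : Injective _≡_ _≡_ w
  w-injective = lookup-injective (filter⁺ meets? (allFin⁺ n))
  w-meets : ∀ i → ClosedNbhd G v (w i) × w i ∈ I
  w-meets i = proj₂ (∈-filter⁻ meets? {xs = allFin n} (∈-lookup i))
  v-w : ∀ i → Graph.Adj G v (w i)
  v-w = independent-in-N[v]⇒adjacent G independent 2≤j w w-injective w-meets
  w≁w : ∀ i i' → ¬ Graph.Adj G (w i) (w i')
  w≁w i i' = independent _ _ (proj₂ (w-meets i)) (proj₂ (w-meets i'))
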